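{- Let $n>1$ be an integer and let $a,b\in\mathbb Z_n$ be incomparable with respect to $\leq$. Let $d=\gcd(\gcd(a,b),n)$. Then the join $a\vee b$ (least upper bound of $\{a,b\}$) exists in $(\mathbb Z_n,\leq)$ if and only if the coset $(n/d)+1=\{x(n/d)+1: x\in\mathbb Z_n\}$ has a smallest element with respect to $\leq$.
   Context: On $\mathbb Z_n$ define the partial order $\leq$ by: $a\leq b$ iff $a=b$ or $a\equiv ab\pmod n$. For $x\in\mathbb Z_n$, $(x)$ denotes the ideal of $\mathbb Z_n$ generated by $x$. Gcds are taken of integer representatives (the value is independent of the choice). -}

module Defs where

open import Data.Nat using (ℕ; _+_; _*_; NonZero; ≢-nonZero; ≢-nonZero⁻¹)
open import Data.Nat.DivMod using (_/_; _mod_)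
open import Data.Nat.GCD using (gcd; gcd[m,n]≢0)
open import Data.Fin using (Fin; toℕ)
open import Data.Sum using (_⊎_; inj₂)
open import Data.Product using (_×_; ∃)
open import Relation.Binary.PropositionalEquality using (_≡_)
open import Relation.Nullary using (¬_)

Zn : ℕ → Set
Zn n = Fin n

mulₙ : (n : ℕ) .{{_ : NonZero n}} → Zn n → Zn n → Zn n
mulₙ n a b = (toℕ a * toℕ b) mod n

Leq : (n : ℕ) .{{_ : NonZero n}} → Zn n → Zn n → Set
Leq n a b = a ≡ b ⊎ a ≡ mulₙ n a b

Incomparable : (n : ℕ) .{{_ : NonZero n}} → Zn n → Zn n → Set
Incomparable n a b = ¬ Leq n a b × ¬ Leq n b a

JoinExists : (n : ℕ) .{{_ : NonZero n}} → Zn n → Zn n → Set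
JoinExists n a b =
  ∃ λ (c : Zn n) → Leq n a c × Leq n b c ×
    ((u : Zn n) → Leq n a u → Leq n b u → Leq n c u)

dOf : (n : ℕ) → Zn n → Zn n → ℕ
dOf n a b = gcd (gcd (toℕ a) (toℕ b)) n

dOf-nonZero : (n : ℕ) .{{_ : NonZero n}} → (a b : Zn n) → NonZero (dOf n a b)
dOf-nonZero n a b = ≢-nonZero (gcd[m,n]≢0 (gcd (toℕ a) (toℕ b)) n (inj₂ (≢-nonZero⁻¹ n)))

nOverD : (n : ℕ) .{{_ : NonZero n}} → Zn n → Zn n → ℕ
nOverD n a b = _/_ n (dOf n a b) {{dOf-nonZero n a b}}

InCoset : (n : ℕ) .{{_ : NonZero n}} → ℕ → Zn n → Set
InCoset n k y = ∃ λ (x : Zn n) → y ≡ (toℕ x * k + 1) mod n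

HasSmallest : (n : ℕ) .{{_ : NonZero n}} → ℕ → Set
HasSmallest n k =
  ∃ λ (m : Zn n) → InCoset n k m × ((y : Zn n) → InCoset n k y → Leq n m y)

-- If a and b are incomparable, a common upper bound u differs from
-- both, so a ≡ a u and b ≡ b u, i.e. n ∣ a (u − 1) and n ∣ b (u − 1). Together
-- these say n ∣ gcd(a, b) (u − 1), i.e. n / d ∣ u − 1, and conversely. So the
-- common upper bounds of a and b are exactly the coset (n / d) + 1, and the
-- join is the smallest element of that coset.
module Submission where

open import Defs
open import Data.Nat using (ℕ; suc; _+_; _*_; _%_; _/_; _<_; NonZero; ≢-nonZero)
open import Data.Nat.Properties
  using (*-suc; *-comm; *-commutativeSemigroup; +-comm; +-cancelˡ-≡; m≤m*n; ≤-<-trans; n<1+n; m<n⇒m<1+n)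
open import Data.Nat.DivMod
  using (_mod_; m%n<n; m%n%n≡m%n; n%n≡0; m<n⇒m%n≡m; m≡m%n+[m/n]*n; %-distribˡ-*; %-remove-+ʳ; m/n*n≡m)
open import Data.Nat.Divisibility
  using (_∣_; divides; ∣-trans; *-monoʳ-∣; m/n∣o⇒m∣o*n; m∣n*o⇒m/n∣o)
open import Data.Nat.GCD using (gcd; gcd[m,n]∣m; gcd[m,n]∣n; gcd-greatest; c*gcd[m,n]≡gcd[cm,cn]; n/gcd[m,n]≢0)
open import Data.Nat.Coprimality using (coprime-/gcd; coprime-divisor) renaming (sym to coprime-sym)
open import Algebra.Properties.CommutativeSemigroup *-commutativeSemigroup using (xy∙z≈xz∙y)
open import Data.Fin using (zero; suc; toℕ; fromℕ<)
open import Data.Fin.Properties using (toℕ-injective; toℕ-fromℕ<; toℕ<n)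
open import Data.Sum using (inj₁; inj₂)
open import Data.Product using (∃; _×_; _,_)
open import Data.Empty using (⊥-elim)
open import Relation.Binary.PropositionalEquality using (_≡_; refl; sym; trans; cong; subst; module ≡-Reasoning)
open import Function.Bundles using (_⇔_; mk⇔; module Equivalence)

private
  variable
    n : ℕ

∣*⇒∣gcd* : ∀ {n} m p o → n ∣ m * o → n ∣ p * o → n ∣ gcd m p * o
∣*⇒∣gcd* {n} m p o n∣mo n∣po =
  subst (n ∣_) (trans (sym (c*gcd[m,n]≡gcd[cm,cn] o m p)) (*-comm o (gcd m p)))
    (gcd-greatest (subst (n ∣_) (*-comm m o) n∣mo) (subst (n ∣_) (*-comm p o) n∣po))

-- m / g and n / g are coprime for g = gcd m n, so n / g ∣ (m / g) o forces n / g ∣ o.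
∣*⇒/gcd∣ : ∀ m n o .{{_ : NonZero n}} .{{_ : NonZero (gcd m n)}} → n ∣ m * o → n / gcd m n ∣ o
∣*⇒/gcd∣ m n o n∣mo = coprime-divisor (coprime-sym (coprime-/gcd m n))
  (m∣n*o⇒m/n∣o (gcd[m,n]∣n m n) (subst (n ∣_) m*o≡m/g*o*g n∣mo))
  where
  open ≡-Reasoning
  g = gcd m n
  m*o≡m/g*o*g : m * o ≡ m / g * o * g
  m*o≡m/g*o*g = begin
    m * o         ≡⟨ cong (_* o) (sym (m/n*n≡m (gcd[m,n]∣m m n))) ⟩
    m / g * g * o ≡⟨ xy∙z≈xz∙y (m / g) g o ⟩
    m / g * o * g ∎

toℕ-mod : ∀ m n .{{_ : NonZero n}} → toℕ (m mod n) ≡ m % n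
toℕ-mod m n = toℕ-fromℕ< (m%n<n m n)

[m*[n%d]]%d≡[m*n]%d : ∀ m n d .{{_ : NonZero d}} → (m * (n % d)) % d ≡ (m * n) % d
[m*[n%d]]%d≡[m*n]%d m n d = begin
  (m * (n % d)) % d           ≡⟨ %-distribˡ-* m (n % d) d ⟩
  (m % d * (n % d % d)) % d   ≡⟨ cong (λ z → (m % d * z) % d) (m%n%n≡m%n n d) ⟩
  (m % d * (n % d)) % d       ≡⟨ sym (%-distribˡ-* m n d) ⟩
  (m * n) % d                 ∎
  where open ≡-Reasoning

m≡[m+o]%n⇔n∣o : ∀ {m n} o .{{_ : NonZero n}} → m < n → (m ≡ (m + o) % n ⇔ n ∣ o)
m≡[m+o]%n⇔n∣o {m} {n} o m<n = mk⇔
  (λ m≡ → divides ((m + o) / n)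
     (+-cancelˡ-≡ m o _ (trans (m≡m%n+[m/n]*n (m + o) n) (cong (_+ (m + o) / n * n) (sym m≡)))))
  (λ n∣o → sym (trans (%-remove-+ʳ m n∣o) (m<n⇒m%n≡m m<n)))

-- Every u : ℤ_n is w + 1 for some w < n; for u = 0 this w is n − 1.
predecessor : .{{_ : NonZero n}} (u : Zn n) → ∃ λ w → w < n × toℕ u ≡ suc w % n
predecessor {suc m} zero    = m , n<1+n m , sym (n%n≡0 (suc m))
predecessor {suc m} (suc i) = toℕ i , m<n⇒m<1+n (toℕ<n i) , sym (m<n⇒m%n≡m (toℕ<n (suc i)))

fixes⇔∣ : .{{_ : NonZero n}} (c u : Zn n) (w : ℕ) → toℕ u ≡ suc w % n →
          (c ≡ mulₙ n c u ⇔ n ∣ toℕ c * w)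
fixes⇔∣ {n} c u w u≡ = mk⇔
  (λ c≡cu → to (trans (cong toℕ c≡cu) cu≡))
  (λ n∣cw → toℕ-injective (trans (from n∣cw) (sym cu≡)))
  where
  open Equivalence (m≡[m+o]%n⇔n∣o (toℕ c * w) (toℕ<n c))
  open ≡-Reasoning
  cu≡ : toℕ (mulₙ n c u) ≡ (toℕ c + toℕ c * w) % n
  cu≡ = begin
    toℕ (mulₙ n c u)           ≡⟨ toℕ-mod _ n ⟩
    (toℕ c * toℕ u) % n        ≡⟨ cong (λ z → (toℕ c * z) % n) u≡ ⟩
    (toℕ c * (suc w % n)) % n  ≡⟨ [m*[n%d]]%d≡[m*n]%d (toℕ c) (suc w) n ⟩
    (toℕ c * suc w) % n        ≡⟨ cong (_% n) (*-suc (toℕ c) w) ⟩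
    (toℕ c + toℕ c * w) % n    ∎

inCoset⇒∣pred : .{{_ : NonZero n}} {k : ℕ} {u : Zn n} → InCoset n k u →
                ∃ λ w → k ∣ w × toℕ u ≡ suc w % n
inCoset⇒∣pred {n} {k} (x , refl) = toℕ x * k , divides (toℕ x) refl ,
  trans (toℕ-mod _ n) (cong (_% n) (+-comm (toℕ x * k) 1))

∣pred⇒inCoset : .{{_ : NonZero n}} {k : ℕ} .{{_ : NonZero k}} (u : Zn n) (w : ℕ) →
                k ∣ w → w < n → toℕ u ≡ suc w % n → InCoset n k u
∣pred⇒inCoset {n} {k} u w (divides q refl) w<n u≡ = fromℕ< q<n , toℕ-injective (begin
  toℕ u                                   ≡⟨ u≡ ⟩
  suc (q * k) % n                         ≡⟨ cong (_% n) (+-comm 1 (q * k)) ⟩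
  (q * k + 1) % n                         ≡⟨ cong (λ z → (z * k + 1) % n) (sym (toℕ-fromℕ< q<n)) ⟩
  (toℕ (fromℕ< q<n) * k + 1) % n          ≡⟨ sym (toℕ-mod _ n) ⟩
  toℕ ((toℕ (fromℕ< q<n) * k + 1) mod n)  ∎)
  where
  open ≡-Reasoning
  q<n : q < n
  q<n = ≤-<-trans (m≤m*n q k) w<n

CommonUpperBound : (n : ℕ) .{{_ : NonZero n}} → Zn n → Zn n → Zn n → Set
CommonUpperBound n a b u = Leq n a u × Leq n b u

module _ .{{_ : NonZero n}} (a b : Zn n) where

  private
    instance
      d≢0 : NonZero (dOf n a b)
      d≢0 = dOf-nonZero n a b

      n/d≢0 : NonZero (nOverD n a b)
      n/d≢0 = ≢-nonZero (n/gcd[m,n]≢0 (gcd (toℕ a) (toℕ b)) n)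

  commonUpperBound⇒inCoset : Incomparable n a b → (u : Zn n) →
                             CommonUpperBound n a b u → InCoset n (nOverD n a b) u
  commonUpperBound⇒inCoset (_ , b≰a) u (inj₁ refl , b≤a) = ⊥-elim (b≰a b≤a)
  commonUpperBound⇒inCoset (a≰b , _) u (inj₂ a≡au , inj₁ refl) = ⊥-elim (a≰b (inj₂ a≡au))
  commonUpperBound⇒inCoset _ u (inj₂ a≡au , inj₂ b≡bu) with predecessor u
  ... | w , w<n , u≡ = ∣pred⇒inCoset u w n/d∣w w<n u≡
    where
    n∣gw : n ∣ gcd (toℕ a) (toℕ b) * w
    n∣gw = ∣*⇒∣gcd* (toℕ a) (toℕ b) w
      (Equivalence.to (fixes⇔∣ a u w u≡) a≡au) (Equivalence.to (fixes⇔∣ b u w u≡) b≡bu)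
    n/d∣w : nOverD n a b ∣ w
    n/d∣w = ∣*⇒/gcd∣ (gcd (toℕ a) (toℕ b)) n w n∣gw

  inCoset⇒upperBound : (c : Zn n) → dOf n a b ∣ toℕ c → (u : Zn n) →
                       InCoset n (nOverD n a b) u → Leq n c u
  inCoset⇒upperBound c d∣c u u∈ with inCoset⇒∣pred u∈
  ... | w , n/d∣w , u≡ = inj₂ (Equivalence.from (fixes⇔∣ c u w u≡) n∣cw)
    where
    n∣cw : n ∣ toℕ c * w
    n∣cw = subst (n ∣_) (*-comm w (toℕ c))
      (∣-trans (m/n∣o⇒m∣o*n (gcd[m,n]∣n (gcd (toℕ a) (toℕ b)) n) n/d∣w) (*-monoʳ-∣ w d∣c))

  inCoset⇒commonUpperBound : (u : Zn n) → InCoset n (nOverD n a b) u → CommonUpperBound n a b u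
  inCoset⇒commonUpperBound u u∈ =
    inCoset⇒upperBound a (∣-trans (gcd[m,n]∣m _ n) (gcd[m,n]∣m (toℕ a) (toℕ b))) u u∈ ,
    inCoset⇒upperBound b (∣-trans (gcd[m,n]∣m _ n) (gcd[m,n]∣n (toℕ a) (toℕ b))) u u∈

theorem3p1 : (n : ℕ) .{{_ : NonZero n}} → 1 < n → (a b : Zn n) →
    Incomparable n a b →
    (JoinExists n a b ⇔ HasSmallest n (nOverD n a b))
theorem3p1 n _ a b a∥b = mk⇔
  (λ { (c , a≤c , b≤c , least) →
         c , toCoset c (a≤c , b≤c) , λ u u∈ → let (a≤u , b≤u) = fromCoset u u∈ in least u a≤u b≤u })
  (λ { (m , m∈ , smallest) → let (a≤m , b≤m) = fromCoset m m∈ in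
         m , a≤m , b≤m , λ u a≤u b≤u → smallest u (toCoset u (a≤u , b≤u)) })
  where
  toCoset : (u : Zn n) → CommonUpperBound n a b u → InCoset n (nOverD n a b) u
  toCoset = commonUpperBound⇒inCoset a b a∥b
  fromCoset : (u : Zn n) → InCoset n (nOverD n a b) u → CommonUpperBound n a b u
  fromCoset = inCoset⇒commonUpperBound a b
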